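{- Let $t\ge 4$ and let $G$ be a graph with no induced cycle of length at least $t$. Let $u,v\in V(G)$ with $\mathrm{dist}_G(u,v)=s$, and let $F\subseteq E(G)$ be a set of at most $k$ edges such that $u$ and $v$ remain connected in $G-F$. Then $\mathrm{dist}_{G-F}(u,v)\le s+k(t-3)$.
   Context: $\mathrm{dist}_H(u,v)$ denotes the length (number of edges) of a shortest $u$–$v$ path in $H$. -}

module Defs where

open import Data.Nat using (ℕ; zero; suc; _≤_; _+_; _*_; _∸_)
open import Data.Fin using (Fin; toℕ)
open import Data.Product using (Σ; ∃; _×_; _,_)
open import Data.Sum using (_⊎_)
open import Data.List using (List; length)
open import Data.List.Membership.Propositional using (_∈_)
open import Relation.Nullary using (¬_; Dec)
open import Relation.Binary.PropositionalEquality using (_≡_)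
open import Function.Definitions using (Injective)
open import Function.Bundles using (_⇔_)

record Graph (n : ℕ) : Set₁ where
  field
    Adj    : Fin n → Fin n → Set
    sym    : ∀ {x y} → Adj x y → Adj y x
    irrefl : ∀ {x} → ¬ Adj x x
    dec    : ∀ x y → Dec (Adj x y)
open Graph public

data Walk {n : ℕ} (R : Fin n → Fin n → Set) : Fin n → Fin n → ℕ → Set where
  [] : ∀ {x} → Walk R x x zero
  _∷_ : ∀ {x y z l} → R x y → Walk R y z l → Walk R x z (suc l)

Dist : ∀ {n} → Graph n → Fin n → Fin n → ℕ → Set
Dist G u v s = Walk (Adj G) u v s × (∀ l → Walk (Adj G) u v l → s ≤ l)

Consec : (ℓ : ℕ) → Fin ℓ → Fin ℓ → Set
Consec ℓ i j =
  (toℕ j ≡ suc (toℕ i)) ⊎ (toℕ i ≡ suc (toℕ j))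
  ⊎ ((suc (toℕ i) ≡ ℓ × toℕ j ≡ 0) ⊎ (suc (toℕ j) ≡ ℓ × toℕ i ≡ 0))

InducedCycle : ∀ {n} → Graph n → ℕ → Set
InducedCycle {n} G ℓ =
  3 ≤ ℓ × Σ (Fin ℓ → Fin n) λ c →
    Injective _≡_ _≡_ c × (∀ i j → Adj G (c i) (c j) ⇔ Consec ℓ i j)

NoLongInducedCycle : ∀ {n} → Graph n → ℕ → Set
NoLongInducedCycle G t = ∀ ℓ → t ≤ ℓ → ¬ InducedCycle G ℓ

EdgeList : ∀ {n} → Graph n → Set
EdgeList {n} G = List (Σ (Fin n × Fin n) λ { (x , y) → Adj G x y })

Del : ∀ {n} (G : Graph n) → EdgeList G → Fin n → Fin n → Set
Del G F x y = Σ (Adj G x y) λ a →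
  (∀ b → ¬ ((x , y) , b) ∈ F) × (∀ b → ¬ ((y , x) , b) ∈ F)

-- If an edge xy of F is reconnected in G − F, a shortest such reconnection
-- closes up with its missing edge into an induced cycle, so it has at most t − 2 edges.
-- Put xy back, take the walk given by induction, and replace its part between the first and
-- the last use of xy by that reconnection: this costs at most t − 3 extra edges.
module Submission where

open import Defs renaming (sym to Adj-sym)
open import Data.Nat using (ℕ; zero; suc; _≤_; _<_; _+_; _*_; _∸_; z≤n; s≤s; s≤s⁻¹)
open import Data.Nat.Properties
open import Data.Nat.Induction using (<-rec)
open import Data.Nat.Tactic.RingSolver using (solve-∀)
open import Data.Fin using (Fin; toℕ) renaming (_≟_ to _≟ᶠ_)
open import Data.Fin.Properties using (any?; toℕ<n; toℕ-injective)
open import Data.Product using (∃; _×_; _,_; proj₁; proj₂)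
open import Data.Product.Properties using (≡-dec)
open import Data.Sum using (_⊎_; inj₁; inj₂)
open import Data.List using ([]; _∷_; _++_; length)
open import Data.List.Properties using (length-++)
open import Data.List.Relation.Unary.Any using (here; there)
import Data.List.Relation.Unary.Any as Any
open import Data.List.Membership.Propositional using (_∈_; find; lose)
open import Data.List.Membership.Propositional.Properties using (∈-∃++; ∈-++⁺ˡ; ∈-++⁺ʳ; ∈-++⁻)
open import Data.Empty using (⊥-elim)
open import Function.Base using (_∘_)
open import Function.Bundles using (mk⇔)
open import Level using (0ℓ)
open import Relation.Binary using (Rel; Symmetric; Decidable; tri<; tri≈; tri>)
open import Relation.Binary.PropositionalEquality
  using (_≡_; _≢_; refl; sym; trans; cong; subst; subst₂)
open import Relation.Nullary using (¬_; Dec; yes; no; _×-dec_; ¬?)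
open import Relation.Nullary.Decidable using (map′; decidable-stable; ¬¬-excluded-middle)
open import Relation.Nullary.Negation using (¬¬-map)

module _ {n : ℕ} {R : Rel (Fin n) 0ℓ} where

  infixr 5 _++ʷ_

  _++ʷ_ : ∀ {a b c l m} → Walk R a b l → Walk R b c m → Walk R a c (l + m)
  []      ++ʷ w′ = w′
  (e ∷ w) ++ʷ w′ = e ∷ (w ++ʷ w′)

  reverse : Symmetric R → ∀ {a b l} → Walk R a b l → Walk R b a l
  reverse R-sym []      = []
  reverse R-sym (e ∷ w) = subst (Walk R _ _) (+-comm _ 1) (reverse R-sym w ++ʷ (R-sym e ∷ []))

  map : ∀ {S : Rel (Fin n) 0ℓ} → (∀ {x y} → R x y → S x y) →
        ∀ {a b l} → Walk R a b l → Walk S a b l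
  map f []      = []
  map f (e ∷ w) = f e ∷ map f w

  -- Positions beyond the length of a walk all denote its last vertex.
  vertex : ∀ {a b l} → Walk R a b l → ℕ → Fin n
  vertex {a} []      _       = a
  vertex {a} (e ∷ w) zero    = a
  vertex     (e ∷ w) (suc i) = vertex w i

  vertex-zero : ∀ {a b l} (w : Walk R a b l) → vertex w 0 ≡ a
  vertex-zero []      = refl
  vertex-zero (e ∷ w) = refl

  vertex-length : ∀ {a b l} (w : Walk R a b l) → vertex w l ≡ b
  vertex-length []      = refl
  vertex-length (e ∷ w) = vertex-length w

  take : ∀ {a b l} (w : Walk R a b l) i → i ≤ l → Walk R a (vertex w i) i
  take []      zero    _       = []
  take (e ∷ w) zero    _       = []
  take (e ∷ w) (suc i) (s≤s p) = e ∷ take w i p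

  drop : ∀ {a b l} (w : Walk R a b l) i → i ≤ l → Walk R (vertex w i) b (l ∸ i)
  drop []      zero    _       = []
  drop (e ∷ w) zero    _       = e ∷ w
  drop (e ∷ w) (suc i) (s≤s p) = drop w i p

  segment : ∀ {a b l} (w : Walk R a b l) {i j} → i ≤ j → j ≤ l →
            Walk R (vertex w i) (vertex w j) (j ∸ i)
  segment w       {zero} {j} _    q       =
    subst (λ a → Walk R a (vertex w j) j) (sym (vertex-zero w)) (take w j q)
  segment (e ∷ w) {suc i} (s≤s p) (s≤s q) = segment w p q

  step : ∀ {a b l} (w : Walk R a b l) i → i < l → R (vertex w i) (vertex w (suc i))
  step (e ∷ w) zero    _       = subst (R _) (sym (vertex-zero w)) e
  step (e ∷ w) (suc i) (s≤s p) = step w i p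

  walk? : Decidable R → ∀ l a b → Dec (Walk R a b l)
  walk? R? zero    a b = map′ (λ { refl → [] }) (λ { [] → refl }) (a ≟ᶠ b)
  walk? R? (suc l) a b = map′ (λ (_ , e , w) → e ∷ w) (λ { (e ∷ w) → _ , e , w })
    (any? λ c → R? a c ×-dec walk? R? l c b)

  short-walk? : Decidable R → ∀ N a b → Dec (∃ λ l → Walk R a b l × l ≤ N)
  short-walk? R? N a b =
    map′ (λ (l , l<N+1 , w) → l , w , s≤s⁻¹ l<N+1) (λ (l , w , l≤N) → l , s≤s l≤N , w)
    (anyUpTo? (λ l → walk? R? l a b) (suc N))

Least : (ℕ → Set) → ℕ → Set
Least P d = P d × (∀ {d′} → P d′ → d ≤ d′)

least : {P : ℕ → Set} → (∀ m → Dec (P m)) → ∀ {m} → P m → ∃ (Least P)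
least {P} P? {m} = <-rec (λ m → P m → ∃ (Least P)) search m
  where
  search : ∀ m → (∀ {m′} → m′ < m → P m′ → ∃ (Least P)) → P m → ∃ (Least P)
  search m rec pm with anyUpTo? P? m
  ... | yes (m′ , m′<m , pm′) = rec m′<m pm′
  ... | no none               = m , pm , λ pd′ → ≮⇒≥ (λ d′<m → none (_ , d′<m , pd′))

Endpoint : ∀ {n} → Fin n → Fin n → Fin n → Set
Endpoint x y z = z ≡ x ⊎ z ≡ y

ShortIfConnected : ∀ {n} → Rel (Fin n) 0ℓ → ℕ → Fin n → Fin n → Set
ShortIfConnected R bound x y = ∀ {m} → Walk R x y m → ∃ λ m′ → m′ ≤ bound × Walk R x y m′

module Reroute {n} {R R′ : Rel (Fin n) 0ℓ} (R? : Decidable R) (R-sym : Symmetric R) {x y : Fin n}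
  (new-edges : ∀ {p q} → R′ p q → ¬ R p q → Endpoint x y p × Endpoint x y q) where

  WalkFromEndpoint : Fin n → ℕ → Set
  WalkFromEndpoint v l = ∃ λ z → Endpoint x y z × ∃ λ m → m ≤ l × Walk R z v m

  data UsesNewEdge (u v : Fin n) : ℕ → Set where
    split : ∀ {z m₁ m₂} → Endpoint x y z → Walk R u z m₁ → WalkFromEndpoint v m₂ →
            UsesNewEdge u v (m₁ + suc m₂)

  last-new-edge : ∀ {p v l} → Walk R′ p v l → Walk R p v l ⊎ WalkFromEndpoint v l
  last-new-edge [] = inj₁ []
  last-new-edge {p} (_∷_ {y = q} e w) with last-new-edge w
  ... | inj₂ (z , z-end , m , m≤l , w′) = inj₂ (z , z-end , m , m≤n⇒m≤1+n m≤l , w′)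
  ... | inj₁ w′ with R? p q
  ...   | yes e′ = inj₁ (e′ ∷ w′)
  ...   | no ¬e′ = inj₂ (q , proj₂ (new-edges e ¬e′) , _ , n≤1+n _ , w′)

  first-new-edge : ∀ {u v l} → Walk R′ u v l → Walk R u v l ⊎ UsesNewEdge u v l
  first-new-edge [] = inj₁ []
  first-new-edge {u} (_∷_ {y = q} e w) with R? u q
  ... | no ¬e′ = inj₂ (split (proj₁ (new-edges e ¬e′)) [] from-endpoint)
    where
    from-endpoint : WalkFromEndpoint _ _
    from-endpoint with last-new-edge w
    ... | inj₁ w′ = q , proj₂ (new-edges e ¬e′) , _ , ≤-refl , w′
    ... | inj₂ r  = r
  ... | yes e′ with first-new-edge w
  ...   | inj₁ w′                  = inj₁ (e′ ∷ w′)
  ...   | inj₂ (split z-end w₁ w₂) = inj₂ (split z-end (e′ ∷ w₁) w₂)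

  short-between-endpoints : ∀ {b} → ShortIfConnected R b x y →
    ∀ {z z′} → Endpoint x y z → Endpoint x y z′ → ShortIfConnected R b z z′
  short-between-endpoints short (inj₁ refl) (inj₁ refl) _ = 0 , z≤n , []
  short-between-endpoints short (inj₂ refl) (inj₂ refl) _ = 0 , z≤n , []
  short-between-endpoints short (inj₁ refl) (inj₂ refl) w = short w
  short-between-endpoints short (inj₂ refl) (inj₁ refl) w
    with m′ , m′≤b , w′ ← short (reverse R-sym w) = m′ , m′≤b , reverse R-sym w′

  -- The walk leaves the old edges at one endpoint and returns for good at one; the two are
  -- joined through the old connection, which the hypothesis shortens to at most c + 1 edges.
  reroute : ∀ {c u v l} → ShortIfConnected R (suc c) x y → ∃ (Walk R u v) → Walk R′ u v l →
            ∃ λ l′ → Walk R u v l′ × l′ ≤ l + c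
  reroute {c} short (_ , w₀) w with first-new-edge w
  ... | inj₁ w′ = _ , w′ , m≤m+n _ c
  ... | inj₂ (split {m₁ = m₁} {m₂} z-end w₁ (z′ , z′-end , m₃ , m₃≤m₂ , w₃))
    with m′ , m′≤c+1 , bridge ←
      short-between-endpoints short z-end z′-end (reverse R-sym w₁ ++ʷ w₀ ++ʷ reverse R-sym w₃)
    = _ , w₁ ++ʷ bridge ++ʷ w₃ , (begin
        m₁ + (m′ + m₃)      ≤⟨ +-monoʳ-≤ m₁ (+-mono-≤ m′≤c+1 m₃≤m₂) ⟩
        m₁ + (suc c + m₂)   ≡⟨ rearrange m₁ m₂ c ⟩
        m₁ + suc m₂ + c     ∎)
    where
    open ≤-Reasoning
    rearrange : ∀ a b c → a + (suc c + b) ≡ a + suc b + c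
    rearrange = solve-∀

module _ {n} (G : Graph n) where

  Listed : EdgeList G → Fin n → Fin n → Set
  Listed F p q = ∃ λ β → ((p , q) , β) ∈ F

  listed? : ∀ F p q → Dec (Listed F p q)
  listed? F p q = map′ from-any (λ (_ , m) → lose m refl)
    (Any.any? (λ f → ≡-dec _≟ᶠ_ _≟ᶠ_ (proj₁ f) (p , q)) F)
    where
    from-any : Any.Any (λ f → proj₁ f ≡ (p , q)) F → Listed F p q
    from-any a with ((_ , _) , β) , m , refl ← find a = β , m

  del? : ∀ F → Decidable (Del G F)
  del? F p q = map′ (λ (a , ¬pq , ¬qp) → a , (λ β m → ¬pq (β , m)) , (λ β m → ¬qp (β , m)))
                    (λ (a , ¬pq , ¬qp) → a , (λ (β , m) → ¬pq β m) , (λ (β , m) → ¬qp β m))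
    (dec G p q ×-dec ¬? (listed? F p q) ×-dec ¬? (listed? F q p))

  del-sym : ∀ F → Symmetric (Del G F)
  del-sym F (a , ¬pq , ¬qp) = Adj-sym G a , ¬qp , ¬pq

  missing⇒listed : ∀ F {p q} → Adj G p q → ¬ Del G F p q → Listed F p q ⊎ Listed F q p
  missing⇒listed F {p} {q} a ¬del with listed? F p q | listed? F q p
  ... | yes l | _     = inj₁ l
  ... | no _  | yes l = inj₂ l
  ... | no ¬pq | no ¬qp = ⊥-elim (¬del (a , (λ β m → ¬pq (β , m)) , (λ β m → ¬qp (β , m))))

  record EdgeDeletion (F : EdgeList G) (x y : Fin n) : Set where
    field
      remaining        : EdgeList G
      length-remaining : length F ≡ suc (length remaining)
      del-⊆            : ∀ {p q} → Del G F p q → Del G remaining p q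
      new-edges        : ∀ {p q} → Del G remaining p q → ¬ Del G F p q →
                         Endpoint x y p × Endpoint x y q

  delete-edge : ∀ {F x y β} → ((x , y) , β) ∈ F → EdgeDeletion F x y
  delete-edge {x = x} {y} {β} m with ys , zs , refl ← ∈-∃++ m = record
    { remaining        = ys ++ zs
    ; length-remaining =
        trans (length-++ ys) (trans (+-suc (length ys) (length zs)) (cong suc (sym (length-++ ys))))
    ; del-⊆            = λ (a , ¬pq , ¬qp) →
                           a , (λ β′ → ¬pq β′ ∘ widen) , (λ β′ → ¬qp β′ ∘ widen)
    ; new-edges        = new-edges
    }
    where
    widen : ∀ {f} → f ∈ ys ++ zs → f ∈ ys ++ ((x , y) , β) ∷ zs
    widen m with ∈-++⁻ ys m
    ... | inj₁ m′ = ∈-++⁺ˡ m′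
    ... | inj₂ m′ = ∈-++⁺ʳ ys (there m′)

    narrow : ∀ {f} → f ∈ ys ++ ((x , y) , β) ∷ zs → f ∈ ys ++ zs ⊎ f ≡ ((x , y) , β)
    narrow m with ∈-++⁻ ys m
    ... | inj₁ m′         = inj₁ (∈-++⁺ˡ m′)
    ... | inj₂ (here eq)  = inj₂ eq
    ... | inj₂ (there m′) = inj₁ (∈-++⁺ʳ ys m′)

    new-edges : ∀ {p q} → Del G (ys ++ zs) p q → ¬ Del G (ys ++ ((x , y) , β) ∷ zs) p q →
                Endpoint x y p × Endpoint x y q
    new-edges (a , ¬pq , ¬qp) ¬del with missing⇒listed (ys ++ ((x , y) , β) ∷ zs) a ¬del
    ... | inj₁ (β′ , m) with narrow m
    ...   | inj₁ m′   = ⊥-elim (¬pq β′ m′)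
    ...   | inj₂ refl = inj₁ refl , inj₂ refl
    new-edges (a , ¬pq , ¬qp) ¬del | inj₂ (β′ , m) with narrow m
    ...   | inj₁ m′   = ⊥-elim (¬qp β′ m′)
    ...   | inj₂ refl = inj₂ refl , inj₁ refl

m<n⇒n∸m≤1⇒n≡1+m : ∀ {m n} → m < n → n ∸ m ≤ 1 → n ≡ suc m
m<n⇒n∸m≤1⇒n≡1+m {zero}  {suc zero}    _         _        = refl
m<n⇒n∸m≤1⇒n≡1+m {zero}  {suc (suc n)} _         (s≤s ())
m<n⇒n∸m≤1⇒n≡1+m {suc m} {suc n}       (s≤s m<n) n∸m≤1    = cong suc (m<n⇒n∸m≤1⇒n≡1+m m<n n∸m≤1)

m<n≤o≤n∸m⇒m≡0∧n≡o : ∀ {m n o} → m < n → n ≤ o → o ≤ n ∸ m → m ≡ 0 × n ≡ o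
m<n≤o≤n∸m⇒m≡0∧n≡o {zero}  _   n≤o o≤n∸m = refl , ≤-antisym n≤o o≤n∸m
m<n≤o≤n∸m⇒m≡0∧n≡o {suc m} m<n n≤o o≤n∸m =
  ⊥-elim (<⇒≱ (∸-monoʳ-< (s≤s z≤n) (<⇒≤ m<n)) (≤-trans n≤o o≤n∸m))

module _ {n} (G : Graph n) {H : Rel (Fin n) 0ℓ} (H? : Decidable H)
         (H⇒Adj : ∀ {x y} → H x y → Adj G x y) where

  Missing : Rel (Fin n) 0ℓ
  Missing a b = Adj G a b × ¬ H a b

  Reconnection : ℕ → Set
  Reconnection d = ∃ λ a → ∃ λ b → Missing a b × Walk H a b d

  reconnection? : ∀ d → Dec (Reconnection d)
  reconnection? d = any? λ a → any? λ b → (dec G a b ×-dec ¬? (H? a b)) ×-dec walk? H? d a b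

  module ShortestReconnection {a b d} (w : Walk H a b d) (ab : Missing a b)
                              (shortest : ∀ {d′} → Reconnection d′ → d ≤ d′) where

    V : ℕ → Fin n
    V = vertex w

    no-shortcut : ∀ {i j e} → i ≤ j → j ≤ d → Walk H (V i) (V j) e → j ∸ i ≤ e
    no-shortcut {i} {j} {e} i≤j j≤d w′ =
      m≤n+o⇒m∸n≤o j i (+-cancelʳ-≤ (d ∸ j) j (i + e) (begin
        j + (d ∸ j)        ≡⟨ m+[n∸m]≡n j≤d ⟩
        d                  ≤⟨ shortest (a , b , ab , shortcut) ⟩
        i + (e + (d ∸ j))  ≡⟨ +-assoc i e (d ∸ j) ⟨
        i + e + (d ∸ j)    ∎))
      where
      open ≤-Reasoning
      shortcut : Walk H a b (i + (e + (d ∸ j)))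
      shortcut = take w i (≤-trans i≤j j≤d) ++ʷ w′ ++ʷ drop w j j≤d

    no-chord : ∀ {i j} → i ≤ j → j ≤ d → Missing (V i) (V j) → d ≤ j ∸ i
    no-chord i≤j j≤d m = shortest (_ , _ , m , segment w i≤j j≤d)

    distinct : ∀ {i j} → i < j → j ≤ d → V i ≢ V j
    distinct {i} i<j j≤d eq = <⇒≱ (m<n⇒0<n∸m i<j)
      (no-shortcut (<⇒≤ i<j) j≤d (subst (λ z → Walk H (V i) z 0) eq []))

    adjacent-positions : ∀ {i j} → i < j → j ≤ d → Adj G (V i) (V j) →
                         j ≡ suc i ⊎ (i ≡ 0 × j ≡ d)
    adjacent-positions {i} {j} i<j j≤d adj with H? (V i) (V j)
    ... | yes h = inj₁ (m<n⇒n∸m≤1⇒n≡1+m i<j (no-shortcut (<⇒≤ i<j) j≤d (h ∷ [])))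
    ... | no ¬h = inj₂ (m<n≤o≤n∸m⇒m≡0∧n≡o i<j j≤d (no-chord (<⇒≤ i<j) j≤d (adj , ¬h)))

    cycle : Fin (suc d) → Fin n
    cycle i = V (toℕ i)

    toℕ≤d : (i : Fin (suc d)) → toℕ i ≤ d
    toℕ≤d i = s≤s⁻¹ (toℕ<n i)

    cycle-injective : ∀ {i j} → cycle i ≡ cycle j → i ≡ j
    cycle-injective {i} {j} eq with <-cmp (toℕ i) (toℕ j)
    ... | tri< i<j _ _ = ⊥-elim (distinct i<j (toℕ≤d j) eq)
    ... | tri≈ _ i≡j _ = toℕ-injective i≡j
    ... | tri> _ _ j<i = ⊥-elim (distinct j<i (toℕ≤d i) (sym eq))

    adj⇒consec : ∀ i j → Adj G (cycle i) (cycle j) → Consec (suc d) i j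
    adj⇒consec i j adj with <-cmp (toℕ i) (toℕ j)
    ... | tri≈ _ i≡j _ =
      ⊥-elim (irrefl G (subst (λ k → Adj G (cycle i) (cycle k)) (sym (toℕ-injective i≡j)) adj))
    ... | tri< i<j _ _ with adjacent-positions i<j (toℕ≤d j) adj
    ...   | inj₁ j≡i+1           = inj₁ j≡i+1
    ...   | inj₂ (i≡0 , j≡d)     = inj₂ (inj₂ (inj₂ (cong suc j≡d , i≡0)))
    adj⇒consec i j adj | tri> _ _ j<i with adjacent-positions j<i (toℕ≤d i) (Adj-sym G adj)
    ...   | inj₁ i≡j+1           = inj₂ (inj₁ i≡j+1)
    ...   | inj₂ (j≡0 , i≡d)     = inj₂ (inj₂ (inj₁ (cong suc i≡d , j≡0)))

    successor-adj : ∀ i j → toℕ j ≡ suc (toℕ i) → Adj G (cycle i) (cycle j)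
    successor-adj i j j≡i+1 = subst (λ k → Adj G (cycle i) (V k)) (sym j≡i+1)
      (H⇒Adj (step w (toℕ i) (subst (_≤ d) j≡i+1 (toℕ≤d j))))

    last-first-adj : ∀ i j → suc (toℕ i) ≡ suc d → toℕ j ≡ 0 → Adj G (cycle i) (cycle j)
    last-first-adj i j i≡d j≡0 =
      subst₂ (Adj G) (trans (sym (vertex-length w)) (cong V (sym (suc-injective i≡d))))
                     (trans (sym (vertex-zero w)) (cong V (sym j≡0)))
                     (Adj-sym G (proj₁ ab))

    consec⇒adj : ∀ i j → Consec (suc d) i j → Adj G (cycle i) (cycle j)
    consec⇒adj i j (inj₁ j≡i+1)                 = successor-adj i j j≡i+1
    consec⇒adj i j (inj₂ (inj₁ i≡j+1))          = Adj-sym G (successor-adj j i i≡j+1)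
    consec⇒adj i j (inj₂ (inj₂ (inj₁ (i≡d , j≡0)))) = last-first-adj i j i≡d j≡0
    consec⇒adj i j (inj₂ (inj₂ (inj₂ (j≡d , i≡0)))) = Adj-sym G (last-first-adj j i j≡d i≡0)

    induced : 2 ≤ d → InducedCycle G (suc d)
    induced 2≤d =
      s≤s 2≤d , cycle , cycle-injective , λ i j → mk⇔ (adj⇒consec i j) (consec⇒adj i j)

  shortest-reconnection-short : ∀ {t} → NoLongInducedCycle G t →
    ∀ {a b d} (w : Walk H a b d) (ab : Missing a b) →
    (∀ {d′} → Reconnection d′ → d ≤ d′) → suc d < t
  shortest-reconnection-short noLong []           ab _        = ⊥-elim (irrefl G (proj₁ ab))
  shortest-reconnection-short noLong (e ∷ [])     ab _        = ⊥-elim (proj₂ ab e)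
  shortest-reconnection-short noLong w@(_ ∷ _ ∷ _) ab shortest =
    ≰⇒> λ t≤ → noLong _ t≤ (ShortestReconnection.induced w ab shortest (s≤s (s≤s z≤n)))

  short-reconnection : ∀ {t} → NoLongInducedCycle G t → ∀ {m} → Reconnection m →
    ∃ λ a → ∃ λ b → Missing a b × ∃ λ d → Walk H a b d × suc d < t
  short-reconnection noLong r with d , (a , b , ab , w) , shortest ← least reconnection? r
    = a , b , ab , d , w , shortest-reconnection-short noLong w ab shortest

m+1<n⇒m≤1+[n∸3] : ∀ {m n} → suc m < n → m ≤ suc (n ∸ 3)
m+1<n⇒m≤1+[n∸3] {n = suc (suc n)} (s≤s (s≤s m≤n)) = ≤-trans m≤n (m≤n+m∸n n 1)

module _ {n} (G : Graph n) {t} (noLong : NoLongInducedCycle G t) where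

  Bypassable : EdgeList G → Set
  Bypassable F = ∃ λ x → ∃ λ y → Listed G F x y × ShortIfConnected (Del G F) (suc (t ∸ 3)) x y

  -- Either some edge of F is reconnected in G − F, and a shortest reconnection has at most
  -- t − 2 edges by the cycle condition, or no edge of F is reconnected at all and any edge
  -- will do. Telling the cases apart needs excluded middle, hence the double negation.
  bypassable-edge : ∀ f F → ¬ ¬ Bypassable (f ∷ F)
  bypassable-edge f@((x , y) , β) F = ¬¬-map cases ¬¬-excluded-middle
    where
    cases : Dec (∃ (Reconnection G (del? G (f ∷ F)) proj₁)) → Bypassable (f ∷ F)
    cases (yes (_ , r))
      with a , b , (adj , ¬del) , d , w , d+1<t ←
             short-reconnection G (del? G (f ∷ F)) proj₁ noLong r
      with missing⇒listed G (f ∷ F) adj ¬del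
    ... | inj₁ l = a , b , l , λ _ → d , m+1<n⇒m≤1+[n∸3] d+1<t , w
    ... | inj₂ l = b , a , l , λ _ → d , m+1<n⇒m≤1+[n∸3] d+1<t , reverse (del-sym G (f ∷ F)) w
    cases (no none) =
      x , y , (β , here refl) ,
      λ w → ⊥-elim (none (_ , x , y , (β , λ del → proj₁ (proj₂ del) β (here refl)) , w))

  short-walk-in-deletion : ∀ {u v s} → Walk (Adj G) u v s → ∀ k F → length F ≤ k →
    ∃ (Walk (Del G F) u v) → ∃ λ l → Walk (Del G F) u v l × l ≤ s + k * (t ∸ 3)
  short-walk-in-deletion {s = s} p k []  _ _ = s , map (λ a → a , (λ _ ()) , (λ _ ())) p , m≤m+n s _
  short-walk-in-deletion p zero (_ ∷ _) () _
  short-walk-in-deletion {u} {v} {s} p (suc k) F@(f ∷ F′) |F|≤k+1 conn =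
    decidable-stable (short-walk? (del? G F) _ u v) (¬¬-map bypass (bypassable-edge f F′))
    where
    c : ℕ
    c = t ∸ 3

    accumulate : ∀ {l l′} → l′ ≤ l + c → l ≤ s + k * c → l′ ≤ s + suc k * c
    accumulate {l} {l′} l′≤ l≤ = begin
      l′               ≤⟨ l′≤ ⟩
      l + c            ≤⟨ +-monoˡ-≤ c l≤ ⟩
      s + k * c + c    ≡⟨ rearrange s (k * c) c ⟩
      s + (c + k * c)  ∎
      where
      open ≤-Reasoning
      rearrange : ∀ a b c → a + b + c ≡ a + (c + b)
      rearrange = solve-∀

    delete-and-reroute : ∀ {x y} → EdgeDeletion G F x y → ShortIfConnected (Del G F) (suc c) x y →
                         ∃ λ l → Walk (Del G F) u v l × l ≤ s + suc k * c
    delete-and-reroute deletion short =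
      let |F′|≤k = s≤s⁻¹ (subst (_≤ suc k) length-remaining |F|≤k+1)
          l , w , l≤ = short-walk-in-deletion p k remaining |F′|≤k (_ , map del-⊆ (proj₂ conn))
          l′ , w′ , l′≤ = Reroute.reroute (del? G F) (del-sym G F) new-edges short conn w
      in l′ , w′ , accumulate l′≤ l≤
      where open EdgeDeletion deletion

    bypass : Bypassable F → ∃ λ l → Walk (Del G F) u v l × l ≤ s + suc k * c
    bypass (x , y , (_ , xy∈F) , short) = delete-and-reroute (delete-edge G xy∈F) short

mainTheorem12 : ∀ (t : ℕ) → 4 ≤ t → ∀ {n} (G : Graph n) → NoLongInducedCycle G t →
    ∀ (u v : Fin n) (s k : ℕ) → Dist G u v s →
    (F : EdgeList G) → length F ≤ k →
    ∃ (λ l → Walk (Del G F) u v l) →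
    ∃ (λ l → Walk (Del G F) u v l × l ≤ s + k * (t ∸ 3))
mainTheorem12 t _ G noLong u v s k (p , _) F |F|≤k conn = short-walk-in-deletion G noLong p k F |F|≤k conn
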